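{- For every integer $n\ge 6$, the pendant path graph $P_n^*$ does not have the $(n-1)$-EKR property.
   Context: All graphs are finite and simple. For a graph $G$ and $r\in\mathbb{N}$, $\mathcal{I}^{(r)}(G)$ denotes the family of independent $r$-subsets of $V(G)$. A subfamily $\mathcal{A}\subseteq\mathcal{I}^{(r)}(G)$ is intersecting if every two members have nonempty intersection. For $v\in V(G)$, the $r$-star centered at $v$ is $\{A\in\mathcal{I}^{(r)}(G): v\in A\}$. A graph $G$ has the $r$-EKR property (is $r$-EKR) if every largest intersecting subfamily of $\mathcal{I}^{(r)}(G)$ is an $r$-star, i.e., all its members contain a common vertex. The pendant path graph $P_n^*$ has vertices $x_1,\dots,x_n,p_1,\dots,p_n$ and edges $x_ix_{i+1}$ for $1\le i\le n-1$ together with $x_ip_i$ for $1\le i\le n$. -}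

module Defs where

open import Data.Nat using (ℕ; zero; suc; _+_; _≤_)
open import Data.Fin using (Fin; toℕ; splitAt)
open import Data.Fin.Subset using (Subset; _∈_; _∩_; Nonempty; ∣_∣)
open import Data.Sum using (_⊎_; inj₁; inj₂)
open import Data.Product using (∃; _×_)
open import Data.Empty using (⊥)
open import Data.List using (List; length)
open import Data.List.Relation.Unary.All using (All)
open import Data.List.Relation.Unary.Unique.Propositional using (Unique)
import Data.List.Membership.Propositional as LM
open import Relation.Binary.PropositionalEquality using (_≡_)
open import Relation.Nullary using (¬_)

Graph : ℕ → Set₁
Graph m = Fin m → Fin m → Set

module _ {m : ℕ} (G : Graph m) where

  IsIndependentSet : ℕ → Subset m → Set
  IsIndependentSet r A = (∣ A ∣ ≡ r) × (∀ u v → u ∈ A → v ∈ A → ¬ G u v)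

  IsSubfamily : ℕ → List (Subset m) → Set
  IsSubfamily r 𝒜 = Unique 𝒜 × All (IsIndependentSet r) 𝒜

  IsIntersecting : List (Subset m) → Set
  IsIntersecting 𝒜 = ∀ A B → A LM.∈ 𝒜 → B LM.∈ 𝒜 → Nonempty (A ∩ B)

  IsIntersectingSubfamily : ℕ → List (Subset m) → Set
  IsIntersectingSubfamily r 𝒜 = IsSubfamily r 𝒜 × IsIntersecting 𝒜

  IsLargestIntersecting : ℕ → List (Subset m) → Set
  IsLargestIntersecting r 𝒜 =
    IsIntersectingSubfamily r 𝒜 ×
    (∀ ℬ → IsIntersectingSubfamily r ℬ → length ℬ ≤ length 𝒜)

  IsStar : List (Subset m) → Set
  IsStar 𝒜 = ∃ λ v → All (v ∈_) 𝒜

  HasEKR : ℕ → Set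
  HasEKR r = ∀ 𝒜 → IsLargestIntersecting r 𝒜 → IsStar 𝒜

-- Pendant path graph P_n^*: vertices x_1..x_n (inj₁ i) and p_1..p_n (inj₂ i)
PEdge : (n : ℕ) → Fin n ⊎ Fin n → Fin n ⊎ Fin n → Set
PEdge n (inj₁ i) (inj₁ j) = (toℕ j ≡ suc (toℕ i)) ⊎ (toℕ i ≡ suc (toℕ j))
PEdge n (inj₁ i) (inj₂ j) = i ≡ j
PEdge n (inj₂ i) (inj₁ j) = i ≡ j
PEdge n (inj₂ i) (inj₂ j) = ⊥

PendantPath : (n : ℕ) → Graph (n + n)
PendantPath n u v = PEdge n (splitAt n u) (splitAt n v)

{-# OPTIONS --safe #-}

-- Let B_j be the set of all pendant vertices except p_j, an independent (n−1)-set. An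
-- independent (n−1)-set A missing B_j would consist of an independent set of the spine path
-- (at most ⌈n/2⌉ vertices) and at most p_j, too few for n ≥ 6; so B_j meets every independent
-- (n−1)-set, including itself. Hence B_j can be added to any intersecting family, and every
-- largest intersecting family contains all the B_j, which have no common vertex. Constructively
-- a largest intersecting family exists only up to double negation, which suffices for a negation.

module Submission where

open import Defs
open import Data.Nat using (ℕ; _≤_; _∸_)
open import Relation.Nullary using (¬_)

open import Algebra.Properties.CommutativeSemigroup using (interchange)
import Data.Bool as Bool
open import Data.Fin using (Fin; toℕ; splitAt; _↑ˡ_; _↑ʳ_)
open import Data.Fin.Properties using (splitAt-↑ˡ; splitAt-↑ʳ; splitAt⁻¹-↑ˡ; splitAt⁻¹-↑ʳ)
open import Data.Fin.Subset
  using (Subset; inside; outside; _∈_; _∉_; _⊆_; _∩_; Nonempty; ∣_∣; ⁅_⁆; ∁)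
  renaming (⊥ to ∅)
open import Data.Fin.Subset.Properties
  using (∉⊥; x∈⁅x⁆; x∈∁p⇒x∉p; x∉∁p⇒x∈p; x∈p∩q⁺; nonempty?; ∩-comm;
         p⊆q⇒∣p∣≤∣q∣; ∣⊥∣≡0; ∣⁅x⁆∣≡1; ∣∁p∣≡n∸∣p∣)
open import Data.List using (List; []; _∷_; [_]; length; map; _++_)
open import Data.List.Membership.Propositional using () renaming (_∈_ to _∈ˡ_)
open import Data.List.Membership.Propositional.Properties using (∈-∃++; ∈-++⁺ˡ; ∈-++⁺ʳ; ∈-map⁺)
open import Data.List.Membership.DecPropositional using () renaming (_∈?_ to _∈ˡ?_)
open import Data.List.Relation.Binary.Subset.Propositional using () renaming (_⊆_ to _⊆ˡ_)
open import Data.List.Relation.Binary.Permutation.Propositional using (↭-sym)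
open import Data.List.Relation.Binary.Permutation.Propositional.Properties using (shift; ∈-resp-↭; ↭-length)
open import Data.List.Relation.Unary.All as All using ([]; _∷_)
open import Data.List.Relation.Unary.All.Properties using (¬Any⇒All¬)
open import Data.List.Relation.Unary.Any using (here; there)
open import Data.List.Relation.Unary.Unique.Propositional using (Unique; []; _∷_)
open import Data.Nat using (zero; suc; _+_; _<_; s≤s; z≤n)
open import Data.Nat.Properties
  using (+-suc; +-comm; +-monoʳ-≤; m≤m+n; ≮⇒≥; +-mono-≤; +-cancelʳ-≤; ≤-trans; m≤n⇒m≤1+n; <⇒≱; 1+n≰n;
         +-commutativeSemigroup; module ≤-Reasoning)
open import Data.Product using (∃; _×_; _,_)
open import Data.Sum using (inj₁; inj₂)
open import Data.Vec using (Vec; []; _∷_; _[_]=_; here; there) renaming (_++_ to _++ᵛ_)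
import Data.Vec as Vec
open import Data.Vec.Properties using (lookup-++ˡ; lookup-++ʳ; []=⇒lookup; lookup⇒[]=; ≡-dec)
open import Function using (_∘_)
open import Relation.Binary.PropositionalEquality using (_≡_; refl; sym; trans; cong; cong₂; subst)
open import Relation.Nullary using (yes; no; contradiction)
open import Relation.Nullary.Decidable using (decidable-stable; ¬¬-excluded-middle)

Unique-⊆⇒length≤ : {A : Set} {xs ys : List A} → Unique xs → xs ⊆ˡ ys → length xs ≤ length ys
Unique-⊆⇒length≤ {xs = []} _ _ = z≤n
Unique-⊆⇒length≤ {xs = x ∷ xs} (x∉xs ∷ unique) x∷xs⊆ys
  with as , bs , refl ← ∈-∃++ (x∷xs⊆ys (here refl)) =
  subst (suc (length xs) ≤_) (↭-length (↭-sym (shift x as bs)))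
        (s≤s (Unique-⊆⇒length≤ unique xs⊆as++bs))
  where
  xs⊆as++bs : xs ⊆ˡ as ++ bs
  xs⊆as++bs y∈xs with ∈-resp-↭ (shift x as bs) (x∷xs⊆ys (there y∈xs))
  ... | here y≡x       = contradiction (sym y≡x) (All.lookup x∉xs y∈xs)
  ... | there y∈as++bs = y∈as++bs

allSubsets : ∀ n → List (Subset n)
allSubsets zero    = [ [] ]
allSubsets (suc n) = map (inside ∷_) (allSubsets n) ++ map (outside ∷_) (allSubsets n)

∈-allSubsets : ∀ {n} (p : Subset n) → p ∈ˡ allSubsets n
∈-allSubsets [] = here refl
∈-allSubsets (inside ∷ p) = ∈-++⁺ˡ (∈-map⁺ (inside ∷_) (∈-allSubsets p))
∈-allSubsets {suc n} (outside ∷ p) =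
  ∈-++⁺ʳ (map (inside ∷_) (allSubsets n)) (∈-map⁺ (outside ∷_) (∈-allSubsets p))

module _ {X : Set} (P : X → Set) (size : X → ℕ) {N : ℕ} (bounded : ∀ {x} → P x → size x ≤ N) where

  IsMaximum : X → Set
  IsMaximum x = P x × (∀ y → P y → size y ≤ size x)

  -- Each climb to a strictly larger witness uses up one unit of the slack k.
  ¬¬-maximum : ∀ {x} → P x → ¬ ¬ ∃ IsMaximum
  ¬¬-maximum {x} Px = climb N Px (m≤m+n N (size x))
    where
    climb : ∀ k {x} → P x → N ≤ k + size x → ¬ ¬ ∃ IsMaximum
    climb zero    {x} Px N≤x noMax = noMax (x , Px , λ y Py → ≤-trans (bounded Py) N≤x)
    climb (suc k) {x} Px N≤k+x noMax = ¬¬-excluded-middle {A = ∃ λ y → P y × size x < size y} λ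
      { (yes (y , Py , x<y)) → climb k Py (N≤k+y x<y) noMax
      ; (no noLarger) → noMax (x , Px , λ y Py → ≮⇒≥ (λ x<y → noLarger (y , Py , x<y))) }
      where
      N≤k+y : ∀ {y} → size x < size y → N ≤ k + size y
      N≤k+y {y} x<y = begin
        N                   ≤⟨ N≤k+x ⟩
        suc k + size x      ≡⟨ +-suc k (size x) ⟨
        k + suc (size x)    ≤⟨ +-monoʳ-≤ k x<y ⟩
        k + size y          ∎
        where open ≤-Reasoning

module _ {A : Set} {a b : ℕ} (xs : Vec A a) (ys : Vec A b) {x : A} where

  []=-++⁺ˡ : ∀ {i} → xs [ i ]= x → (xs ++ᵛ ys) [ i ↑ˡ b ]= x
  []=-++⁺ˡ {i} xs[i]=x = lookup⇒[]= (i ↑ˡ b) (xs ++ᵛ ys) (trans (lookup-++ˡ xs ys i) ([]=⇒lookup xs[i]=x))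

  []=-++⁻ˡ : ∀ {i} → (xs ++ᵛ ys) [ i ↑ˡ b ]= x → xs [ i ]= x
  []=-++⁻ˡ {i} [i]=x = lookup⇒[]= i xs (trans (sym (lookup-++ˡ xs ys i)) ([]=⇒lookup [i]=x))

  []=-++⁺ʳ : ∀ {i} → ys [ i ]= x → (xs ++ᵛ ys) [ a ↑ʳ i ]= x
  []=-++⁺ʳ {i} ys[i]=x = lookup⇒[]= (a ↑ʳ i) (xs ++ᵛ ys) (trans (lookup-++ʳ xs ys i) ([]=⇒lookup ys[i]=x))

  []=-++⁻ʳ : ∀ {i} → (xs ++ᵛ ys) [ a ↑ʳ i ]= x → ys [ i ]= x
  []=-++⁻ʳ {i} [i]=x = lookup⇒[]= i ys (trans (sym (lookup-++ʳ xs ys i)) ([]=⇒lookup [i]=x))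

∣p++q∣≡∣p∣+∣q∣ : ∀ {a b} (p : Subset a) (q : Subset b) → ∣ p ++ᵛ q ∣ ≡ ∣ p ∣ + ∣ q ∣
∣p++q∣≡∣p∣+∣q∣ []             q = refl
∣p++q∣≡∣p∣+∣q∣ (inside ∷ p)  q = cong suc (∣p++q∣≡∣p∣+∣q∣ p q)
∣p++q∣≡∣p∣+∣q∣ (outside ∷ p) q = ∣p++q∣≡∣p∣+∣q∣ p q

ConsecutiveFree : ∀ {n} → Subset n → Set
ConsecutiveFree p = ∀ {i j} → toℕ j ≡ suc (toℕ i) → i ∈ p → j ∉ p

consecutiveFree-tail : ∀ {n s} {p : Subset n} → ConsecutiveFree (s ∷ p) → ConsecutiveFree p
consecutiveFree-tail free j≡1+i i∈p = free (cong suc j≡1+i) (there i∈p) ∘ there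

consecutiveFree⇒∣p∣+∣p∣≤1+n : ∀ {n} {p : Subset n} → ConsecutiveFree p → ∣ p ∣ + ∣ p ∣ ≤ suc n
consecutiveFree⇒∣p∣+∣p∣≤1+n {p = []} free = z≤n
consecutiveFree⇒∣p∣+∣p∣≤1+n {p = outside ∷ p} free =
  m≤n⇒m≤1+n (consecutiveFree⇒∣p∣+∣p∣≤1+n (consecutiveFree-tail free))
consecutiveFree⇒∣p∣+∣p∣≤1+n {p = inside ∷ []} free = s≤s (s≤s z≤n)
consecutiveFree⇒∣p∣+∣p∣≤1+n {p = inside ∷ inside ∷ p} free = contradiction (there here) (free refl here)
consecutiveFree⇒∣p∣+∣p∣≤1+n {suc (suc n)} {p = inside ∷ outside ∷ p} free =
  s≤s (subst (_≤ suc (suc n)) (sym (+-suc ∣ p ∣ ∣ p ∣))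
    (s≤s (consecutiveFree⇒∣p∣+∣p∣≤1+n (consecutiveFree-tail (consecutiveFree-tail free)))))

module _ {m : ℕ} (G : Graph m) (r : ℕ) where

  IsTransversal : Subset m → Set
  IsTransversal B = ∀ {A} → IsIndependentSet G r A → Nonempty (B ∩ A)

  transversal∈largest : ∀ {B 𝒜} → IsIndependentSet G r B → IsTransversal B →
                        IsLargestIntersecting G r 𝒜 → B ∈ˡ 𝒜
  transversal∈largest {B} {𝒜} indepB transB (((unique , indep) , intersecting) , largest) =
    decidable-stable (_∈ˡ?_ (≡-dec Bool._≟_) B 𝒜) λ B∉𝒜 →
      1+n≰n (largest (B ∷ 𝒜) ((¬Any⇒All¬ 𝒜 B∉𝒜 ∷ unique , indepB ∷ indep) , intersecting′))
    where
    intersecting′ : IsIntersecting G (B ∷ 𝒜)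
    intersecting′ _ _ (here refl) (here refl) = transB indepB
    intersecting′ _ C (here refl) (there C∈𝒜) = transB (All.lookup indep C∈𝒜)
    intersecting′ A _ (there A∈𝒜) (here refl) = subst Nonempty (∩-comm B A) (transB (All.lookup indep A∈𝒜))
    intersecting′ A C (there A∈𝒜) (there C∈𝒜) = intersecting A C A∈𝒜 C∈𝒜

  ¬¬-largestIntersecting : ¬ ¬ ∃ (IsLargestIntersecting G r)
  ¬¬-largestIntersecting = ¬¬-maximum (IsIntersectingSubfamily G r) length bounded empty
    where
    bounded : ∀ {𝒜} → IsIntersectingSubfamily G r 𝒜 → length 𝒜 ≤ length (allSubsets m)
    bounded ((unique , _) , _) = Unique-⊆⇒length≤ unique (λ {A} _ → ∈-allSubsets A)
    empty : IsIntersectingSubfamily G r []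
    empty = ([] , []) , λ _ _ ()

  transversals⇒¬HasEKR : {I : Set} (B : I → Subset m) →
                         (∀ i → IsIndependentSet G r (B i)) → (∀ i → IsTransversal (B i)) →
                         (∀ v → ∃ λ i → v ∉ B i) → ¬ HasEKR G r
  transversals⇒¬HasEKR B indep trans noCommonVertex ekr = ¬¬-largestIntersecting λ (𝒜 , largest) →
    let v , v∈all = ekr 𝒜 largest
        i , v∉Bi  = noCommonVertex v
    in v∉Bi (All.lookup v∈all (transversal∈largest (indep i) (trans i) largest))

module _ {n : ℕ} where

  data Vertex : Fin (n + n) → Set where
    spine   : ∀ i → Vertex (i ↑ˡ n)
    pendant : ∀ i → Vertex (n ↑ʳ i)

  vertex : ∀ v → Vertex v
  vertex v with splitAt n v in eq
  ... | inj₁ i = subst Vertex (splitAt⁻¹-↑ˡ eq) (spine i)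
  ... | inj₂ i = subst Vertex (splitAt⁻¹-↑ʳ eq) (pendant i)

  spine-adjacent : ∀ {i j} → toℕ j ≡ suc (toℕ i) → PendantPath n (i ↑ˡ n) (j ↑ˡ n)
  spine-adjacent {i} {j} j≡1+i rewrite splitAt-↑ˡ n i n | splitAt-↑ˡ n j n = inj₁ j≡1+i

  pendants-nonadjacent : ∀ i j → ¬ PendantPath n (n ↑ʳ i) (n ↑ʳ j)
  pendants-nonadjacent i j rewrite splitAt-↑ʳ n n i | splitAt-↑ʳ n n j = λ ()

  pendantsExcept : Fin n → Subset (n + n)
  pendantsExcept j = ∅ ++ᵛ ∁ ⁅ j ⁆

  spine∉pendantsExcept : ∀ {i j} → i ↑ˡ n ∉ pendantsExcept j
  spine∉pendantsExcept {j = j} = ∉⊥ ∘ []=-++⁻ˡ ∅ (∁ ⁅ j ⁆)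

  pendantsExcept-independent : ∀ j → IsIndependentSet (PendantPath n) (n ∸ 1) (pendantsExcept j)
  pendantsExcept-independent j = size , independent
    where
    size : ∣ pendantsExcept j ∣ ≡ n ∸ 1
    size rewrite ∣p++q∣≡∣p∣+∣q∣ (∅ {n}) (∁ ⁅ j ⁆) | ∣⊥∣≡0 n | ∣∁p∣≡n∸∣p∣ ⁅ j ⁆ | ∣⁅x⁆∣≡1 j = refl
    independent : ∀ u v → u ∈ pendantsExcept j → v ∈ pendantsExcept j → ¬ PendantPath n u v
    independent u v u∈ v∈ with vertex u | vertex v
    ... | spine _   | _         = contradiction u∈ spine∉pendantsExcept
    ... | pendant _ | spine _   = contradiction v∈ spine∉pendantsExcept
    ... | pendant i | pendant k = pendants-nonadjacent i k

  pendantsExcept-noCommonVertex : ∀ v → ∃ λ j → v ∉ pendantsExcept j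
  pendantsExcept-noCommonVertex v with vertex v
  ... | spine i   = i , spine∉pendantsExcept
  ... | pendant k = k , λ p∈ → x∈∁p⇒x∉p ([]=-++⁻ʳ ∅ (∁ ⁅ k ⁆) p∈) (x∈⁅x⁆ k)

  avoiding-pendantsExcept⇒∣A∣+∣A∣≤3+n :
    ∀ j (xs ys : Subset n) → (∀ u v → u ∈ xs ++ᵛ ys → v ∈ xs ++ᵛ ys → ¬ PendantPath n u v) →
    ¬ Nonempty (pendantsExcept j ∩ (xs ++ᵛ ys)) → ∣ xs ++ᵛ ys ∣ + ∣ xs ++ᵛ ys ∣ ≤ 3 + n
  avoiding-pendantsExcept⇒∣A∣+∣A∣≤3+n j xs ys independent misses = begin
    ∣ xs ++ᵛ ys ∣ + ∣ xs ++ᵛ ys ∣         ≡⟨ cong₂ _+_ (∣p++q∣≡∣p∣+∣q∣ xs ys) (∣p++q∣≡∣p∣+∣q∣ xs ys) ⟩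
    (∣ xs ∣ + ∣ ys ∣) + (∣ xs ∣ + ∣ ys ∣) ≡⟨ interchange +-commutativeSemigroup (∣ xs ∣) (∣ ys ∣) (∣ xs ∣) (∣ ys ∣) ⟩
    (∣ xs ∣ + ∣ xs ∣) + (∣ ys ∣ + ∣ ys ∣) ≤⟨ +-mono-≤ spine-bound (+-mono-≤ pendant-bound pendant-bound) ⟩
    suc n + 2                           ≡⟨ +-comm (suc n) 2 ⟩
    3 + n                               ∎
    where
    open ≤-Reasoning
    spine-bound : ∣ xs ∣ + ∣ xs ∣ ≤ suc n
    spine-bound = consecutiveFree⇒∣p∣+∣p∣≤1+n λ i′≡1+i i∈xs i′∈xs →
      independent _ _ ([]=-++⁺ˡ xs ys i∈xs) ([]=-++⁺ˡ xs ys i′∈xs) (spine-adjacent i′≡1+i)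
    ys⊆⁅j⁆ : ys ⊆ ⁅ j ⁆
    ys⊆⁅j⁆ {k} k∈ys = x∉∁p⇒x∈p λ k∈∁⁅j⁆ →
      misses (n ↑ʳ k , x∈p∩q⁺ ([]=-++⁺ʳ ∅ (∁ ⁅ j ⁆) k∈∁⁅j⁆ , []=-++⁺ʳ xs ys k∈ys))
    pendant-bound : ∣ ys ∣ ≤ 1
    pendant-bound = subst (∣ ys ∣ ≤_) (∣⁅x⁆∣≡1 j) (p⊆q⇒∣p∣≤∣q∣ ys⊆⁅j⁆)

[n∸1]+[n∸1]≤3+n⇒n≤5 : ∀ n → (n ∸ 1) + (n ∸ 1) ≤ 3 + n → n ≤ 5
[n∸1]+[n∸1]≤3+n⇒n≤5 zero    _  = z≤n
[n∸1]+[n∸1]≤3+n⇒n≤5 (suc m) le = s≤s (+-cancelʳ-≤ m m 4 le)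

pendantsExcept-transversal : ∀ {n} → 6 ≤ n → ∀ j → IsTransversal (PendantPath n) (n ∸ 1) (pendantsExcept j)
pendantsExcept-transversal {n} 6≤n j {A} (∣A∣≡n∸1 , independent)
  with xs , ys , refl ← Vec.splitAt n A =
  decidable-stable (nonempty? _) λ misses →
    <⇒≱ 6≤n ([n∸1]+[n∸1]≤3+n⇒n≤5 n (subst (λ s → s + s ≤ 3 + n) ∣A∣≡n∸1
      (avoiding-pendantsExcept⇒∣A∣+∣A∣≤3+n j xs ys independent misses)))

theorem7 : ∀ (n : ℕ) → 6 ≤ n → ¬ HasEKR (PendantPath n) (n ∸ 1)
theorem7 n 6≤n = transversals⇒¬HasEKR (PendantPath n) (n ∸ 1) pendantsExcept
  pendantsExcept-independent (pendantsExcept-transversal 6≤n) pendantsExcept-noCommonVertex
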